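{- Let $\{a,b\}$ and $\{a,c\}$ be incomparable pairs in a graph $H$. Then $\{a,b\}\leadsto\{a,c\}$.
   Context: Graphs may have loops; $\Gamma(v)$ is the neighborhood of $v$ ($v\in\Gamma(v)$ iff looped). A pair $\{u,v\}$ of distinct vertices is incomparable if neither $\Gamma(u)\subseteq\Gamma(v)$ nor $\Gamma(v)\subseteq\Gamma(u)$. A move is a triple $\mathcal J=(J,L,(x,y))$ with $J$ a graph, $L:V(J)\to2^{V(H)}$, $x,y\in V(J)$. For $u\in L(x)$, $v\in L(y)$, $\mathrm{cost}(\mathcal J,(u,v))$ is the minimum size of $F\subseteq E(J)$ such that some $\phi:V(J)\to V(H)$ satisfies $\phi(w)\in L(w)$, $\phi(w)\phi(w')\in E(H)$ for $ww'\in E(J)\setminus F$, $\phi(x)=u$, $\phi(y)=v$. $\mathcal J(u)$ is the set of $v\in L(y)$ minimizing $\mathrm{cost}(\mathcal J,(u,v))$; $\mathcal J$ forces $u\to v$ if $\mathcal J(u)=\{v\}$. $(a,b)\to(c,d)$ means there is a move with $L(x)=\{a,b\}$, $L(y)=\{c,d\}$ forcing $a\to c$ and $b\to d$; $\{a,b\}\leadsto\{c,d\}$ means $(a,b)\to(c,d)$ or $(a,b)\to(d,c)$. -}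

module Defs where

open import Data.Bool using (Bool; true; false; _∧_; if_then_else_)
open import Data.Nat using (ℕ; zero; suc; _+_; _≤_; _≤ᵇ_)
open import Data.Fin using (Fin; toℕ)
import Data.Fin as F
open import Data.Fin.Subset using (Subset; _∈_; ⁅_⁆; _∪_)
open import Data.Maybe using (Maybe; just; nothing)
open import Data.Product using (Σ; _×_; _,_)
open import Data.Sum using (_⊎_)
open import Data.Unit using (⊤)
open import Data.Empty using (⊥)
open import Relation.Nullary using (¬_)
open import Relation.Binary.PropositionalEquality using (_≡_; _≢_)

-- A finite graph, possibly with loops, on vertex set Fin n.
-- adj u v ≡ true  iff  uv is an edge (u ≡ v allowed: a loop).
record Graph (n : ℕ) : Set where
  field
    adj     : Fin n → Fin n → Bool
    adj-sym : ∀ u v → adj u v ≡ adj v u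
open Graph public

NbhdSub : ∀ {n} → Graph n → Fin n → Fin n → Set
NbhdSub H u v = ∀ w → adj H u w ≡ true → adj H v w ≡ true

Incomparable : ∀ {n} → Graph n → Fin n → Fin n → Set
Incomparable H u v = u ≢ v × ¬ NbhdSub H u v × ¬ NbhdSub H v u

sumFin : ∀ {m} → (Fin m → ℕ) → ℕ
sumFin {zero}  f = 0
sumFin {suc m} f = f F.zero + sumFin (λ i → f (F.suc i))

-- An edge set F ⊆ E(J), represented as a symmetric Boolean relation
-- contained in the adjacency of J.  Its size counts unordered pairs
-- {i,j} (with i = j allowed, for loops) once, via i ≤ j.
EdgeSubset : ∀ {m} → Graph m → (Fin m → Fin m → Bool) → Set
EdgeSubset J Fs = (∀ i j → Fs i j ≡ Fs j i) × (∀ i j → Fs i j ≡ true → adj J i j ≡ true)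

edgeCount : ∀ {m} → (Fin m → Fin m → Bool) → ℕ
edgeCount Fs = sumFin (λ i → sumFin (λ j →
  if Fs i j ∧ (toℕ i ≤ᵇ toℕ j) then 1 else 0))

record Move (n : ℕ) : Set where
  field
    m : ℕ
    J : Graph m
    L : Fin m → Subset n
    x : Fin m
    y : Fin m
open Move public

-- F witnesses that cost(𝒥,(u,v)) ≤ |F|: some list map φ with φ(x)=u, φ(y)=v
-- is a homomorphism on E(J) ∖ F.
Feasible : ∀ {n} → Graph n → (M : Move n) → Fin n → Fin n → (Fin (m M) → Fin (m M) → Bool) → Set
Feasible H M u v Fs =
  EdgeSubset (J M) Fs ×
  Σ (Fin (m M) → Fin _) λ φ →
    (∀ w → φ w ∈ L M w) ×
    (∀ w w' → adj (J M) w w' ≡ true → Fs w w' ≡ false → adj H (φ w) (φ w') ≡ true) ×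
    φ (x M) ≡ u × φ (y M) ≡ v

-- HasCost H M u v c : cost(𝒥,(u,v)) = c, where nothing = ∞ (no feasible F exists).
HasCost : ∀ {n} → Graph n → (M : Move n) → Fin n → Fin n → Maybe ℕ → Set
HasCost H M u v (just k) =
  Σ (Fin (m M) → Fin (m M) → Bool) (λ Fs → Feasible H M u v Fs × edgeCount Fs ≡ k) ×
  (∀ Fs → Feasible H M u v Fs → k ≤ edgeCount Fs)
HasCost H M u v nothing = ∀ Fs → ¬ Feasible H M u v Fs

_≤∞_ : Maybe ℕ → Maybe ℕ → Set
just a  ≤∞ just b  = a ≤ b
_       ≤∞ nothing = ⊤
nothing ≤∞ just _  = ⊥

InImage : ∀ {n} → Graph n → Move n → Fin n → Fin n → Set
InImage H M u v =
  v ∈ L M (y M) ×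
  (∀ w → w ∈ L M (y M) → ∀ cv cw → HasCost H M u v cv → HasCost H M u w cw → cv ≤∞ cw)

Forces : ∀ {n} → Graph n → Move n → Fin n → Fin n → Set
Forces H M u v = InImage H M u v × (∀ w → InImage H M u w → w ≡ v)

Arrow : ∀ {n} → Graph n → Fin n → Fin n → Fin n → Fin n → Set
Arrow {n} H a b c d = Σ (Move n) λ M →
  L M (x M) ≡ ⁅ a ⁆ ∪ ⁅ b ⁆ × L M (y M) ≡ ⁅ c ⁆ ∪ ⁅ d ⁆ ×
  Forces H M a c × Forces H M b d

Leads : ∀ {n} → Graph n → Fin n → Fin n → Fin n → Fin n → Set
Leads H a b c d = Arrow H a b c d ⊎ Arrow H a b d c

{-# OPTIONS --safe #-}
-- Pick b' ∈ Γ(a)∖Γ(b), a' ∈ Γ(b)∖Γ(a), c' ∈ Γ(a)∖Γ(c) and a'' ∈ Γ(c)∖Γ(a).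
-- All moves are one gadget: x (list {a,b}) and y (list {c,d}) are both joined
-- to two vertices with list {p,q}, and y has a pendant neighbour with list {t}.
-- Routing both middle vertices through the best s, its cost on (u,v) is
-- 2·min_{s ∈ {p,q}} ([u ≁ s] + [v ≁ s]) + [v ≁ t].  If the witnesses contain a
-- neighbour of a missing b and c and a common neighbour of b and c missing a,
-- this forces a → a and b → c; otherwise one of two crossed configurations of
-- the witnesses forces a → c and b → a.
module Submission where

open import Defs
open import Data.Bool using (Bool; true; false; not; _∧_; _∨_; if_then_else_)
open import Data.Bool.Properties using (_≟_; ∨-comm)
open import Data.Nat using (ℕ; _+_; _⊓_; _≤_; _<_; _≤ᵇ_; z≤n)
open import Data.Nat.Properties
  using (≤-refl; ≤-trans; ≤-antisym; <⇒≤; <⇒≱; +-mono-≤; ⊓-sel; m⊓n≤m; m⊓n≤n; <ᵇ⇒<)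
open import Data.Nat.Tactic.RingSolver using (solve-∀)
open import Data.Fin using (Fin; toℕ)
import Data.Fin as F
open import Data.Fin.Properties using (¬∀⟶∃¬)
open import Data.Fin.Subset using (Subset; _∈_; ⁅_⁆; _∪_)
open import Data.Fin.Subset.Properties using (x∈⁅x⁆; x∈⁅y⁆⇒x≡y; x∈p∪q⁻; x∈p∪q⁺)
open import Data.Maybe using (just; nothing)
open import Data.Product using (∃; _×_; _,_)
open import Data.Sum using (_⊎_; inj₁; inj₂; swap)
open import Data.Empty using (⊥-elim)
open import Function using (_∘_)
open import Relation.Nullary using (¬_)
open import Relation.Nullary.Decidable using (_→-dec_)
open import Relation.Binary.PropositionalEquality using (_≡_; refl; sym; cong; trans)

∈-pair⁻ : ∀ {n} {p q z : Fin n} → z ∈ ⁅ p ⁆ ∪ ⁅ q ⁆ → z ≡ p ⊎ z ≡ q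
∈-pair⁻ {p = p} {q} z∈ with x∈p∪q⁻ ⁅ p ⁆ ⁅ q ⁆ z∈
... | inj₁ z∈p = inj₁ (x∈⁅y⁆⇒x≡y p z∈p)
... | inj₂ z∈q = inj₂ (x∈⁅y⁆⇒x≡y q z∈q)

∈-pairˡ : ∀ {n} (p q : Fin n) → p ∈ ⁅ p ⁆ ∪ ⁅ q ⁆
∈-pairˡ p q = x∈p∪q⁺ (inj₁ (x∈⁅x⁆ p))

∈-pairʳ : ∀ {n} (p q : Fin n) → q ∈ ⁅ p ⁆ ∪ ⁅ q ⁆
∈-pairʳ p q = x∈p∪q⁺ (inj₂ (x∈⁅x⁆ q))

¬→-true⇒true,false : ∀ {A B : Bool} → ¬ (A ≡ true → B ≡ true) → A ≡ true × B ≡ false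
¬→-true⇒true,false {true}  {false} _ = refl , refl
¬→-true⇒true,false {true}  {true}  h = ⊥-elim (h λ _ → refl)
¬→-true⇒true,false {false}         h = ⊥-elim (h λ ())

¬NbhdSub⇒∃ : ∀ {n} (H : Graph n) u w → ¬ NbhdSub H u w →
  ∃ λ z → adj H u z ≡ true × adj H w z ≡ false
¬NbhdSub⇒∃ {n} H u w u⊈w with ¬∀⟶∃¬ n _ (λ z → (adj H u z ≟ true) →-dec (adj H w z ≟ true)) u⊈w
... | z , ¬uz→wz = z , ¬→-true⇒true,false ¬uz→wz

sumFin-mono : ∀ {k} {f g : Fin k → ℕ} → (∀ i → f i ≤ g i) → sumFin f ≤ sumFin g
sumFin-mono {ℕ.zero}  f≤g = z≤n
sumFin-mono {ℕ.suc k} f≤g = +-mono-≤ (f≤g F.zero) (sumFin-mono (f≤g ∘ F.suc))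

sumFin-cong : ∀ {k} {f g : Fin k → ℕ} → (∀ i → f i ≡ g i) → sumFin f ≡ sumFin g
sumFin-cong {ℕ.zero}  f≗g = refl
sumFin-cong {ℕ.suc k} f≗g rewrite f≗g F.zero | sumFin-cong (f≗g ∘ F.suc) = refl

violationSet : ∀ {m n} → Graph m → Graph n → (Fin m → Fin n) → Fin m → Fin m → Bool
violationSet J H φ i j = adj J i j ∧ not (adj H (φ i) (φ j))

violations : ∀ {m n} → Graph m → Graph n → (Fin m → Fin n) → ℕ
violations J H φ = edgeCount (violationSet J H φ)

violation≤deletion : ∀ A X D L → (A ≡ true → D ≡ false → X ≡ true) →
  (if (A ∧ not X) ∧ L then 1 else 0) ≤ (if D ∧ L then 1 else 0)
violation≤deletion false X     D     L     _ = z≤n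
violation≤deletion true  true  D     L     _ = z≤n
violation≤deletion true  false true  L     _ = ≤-refl
violation≤deletion true  false false false _ = z≤n
violation≤deletion true  false false true  h with h refl refl
... | ()

module MoveCost {n} (H : Graph n) (M : Move n) where

  ListMap : Fin n → Fin n → (Fin (m M) → Fin n) → Set
  ListMap u v φ = (∀ w → φ w ∈ L M w) × φ (x M) ≡ u × φ (y M) ≡ v

  violationSet-feasible : ∀ {u v φ} → ListMap u v φ → Feasible H M u v (violationSet (J M) H φ)
  violationSet-feasible {φ = φ} (φ∈L , φx , φy) =
    ( (λ i j → cong₂∧not (adj-sym (J M) i j) (adj-sym H (φ i) (φ j)))
    , (λ i j → ∧-true-left (adj (J M) i j)) )
    , φ , φ∈L , (λ i j → kept (adj (J M) i j) (adj H (φ i) (φ j))) , φx , φy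
    where
    cong₂∧not : ∀ {A A' X X'} → A ≡ A' → X ≡ X' → A ∧ not X ≡ A' ∧ not X'
    cong₂∧not refl refl = refl
    ∧-true-left : ∀ A {B} → A ∧ B ≡ true → A ≡ true
    ∧-true-left true _ = refl
    kept : ∀ A X → A ≡ true → A ∧ not X ≡ false → X ≡ true
    kept true true _ _ = refl

  violations≤edgeCount : ∀ {Fs} (φ : Fin (m M) → Fin n) →
    (∀ w w' → adj (J M) w w' ≡ true → Fs w w' ≡ false → adj H (φ w) (φ w') ≡ true) →
    violations (J M) H φ ≤ edgeCount Fs
  violations≤edgeCount {Fs = Fs} φ hom = sumFin-mono λ i → sumFin-mono λ j →
    violation≤deletion (adj (J M) i j) (adj H (φ i) (φ j)) (Fs i j) (toℕ i ≤ᵇ toℕ j) (hom i j)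

  hasCost-of-optimal : ∀ {u v k} φ → ListMap u v φ → violations (J M) H φ ≡ k →
    (∀ ψ → ListMap u v ψ → k ≤ violations (J M) H ψ) → HasCost H M u v (just k)
  hasCost-of-optimal φ φ-ok refl optimal =
    (violationSet (J M) H φ , violationSet-feasible φ-ok , refl) , lower
    where
    lower : ∀ Fs → Feasible H M _ _ Fs → violations (J M) H φ ≤ edgeCount Fs
    lower Fs (_ , ψ , ψ∈L , hom , ψx , ψy) =
      ≤-trans (optimal ψ (ψ∈L , ψx , ψy)) (violations≤edgeCount ψ hom)

  hasCost-functional : ∀ {u v k} c → HasCost H M u v (just k) → HasCost H M u v c → c ≡ just k
  hasCost-functional nothing  ((Fs , feasible , _) , _) infeasible = ⊥-elim (infeasible Fs feasible)
  hasCost-functional (just l) ((Fs , feasible , refl) , minimal) ((Fs' , feasible' , refl) , minimal') =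
    cong just (≤-antisym (minimal' Fs feasible) (minimal Fs' feasible'))

  forces-by-cost : ∀ {u v w k l} → v ∈ L M (y M) → (∀ z → z ∈ L M (y M) → z ≡ v ⊎ z ≡ w) →
    HasCost H M u v (just k) → HasCost H M u w (just l) → k < l → Forces H M u v
  forces-by-cost {u} {v} {w} {k} {l} v∈ only-v,w cost-v cost-w k<l = (v∈ , v-minimal) , v-only
    where
    v-minimal : ∀ z → z ∈ L M (y M) → ∀ cv cz → HasCost H M u v cv → HasCost H M u z cz → cv ≤∞ cz
    v-minimal z z∈ cv cz hv hz with hasCost-functional cv cost-v hv | only-v,w z z∈
    ... | refl | inj₁ refl with hasCost-functional cz cost-v hz
    ...   | refl = ≤-refl
    v-minimal z z∈ cv cz hv hz | refl | inj₂ refl with hasCost-functional cz cost-w hz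
    ...   | refl = <⇒≤ k<l
    v-only : ∀ z → InImage H M u z → z ≡ v
    v-only z (z∈ , z-minimal) with only-v,w z z∈
    ... | inj₁ z≡v  = z≡v
    ... | inj₂ refl = ⊥-elim (<⇒≱ k<l (z-minimal v v∈ (just l) (just k) cost-w cost-v))

pattern vx = F.zero
pattern vy = F.suc F.zero
pattern s₁ = F.suc (F.suc F.zero)
pattern s₂ = F.suc (F.suc (F.suc F.zero))
pattern vt = F.suc (F.suc (F.suc (F.suc F.zero)))

gadgetArc : Fin 5 → Fin 5 → Bool
gadgetArc vx s₁ = true
gadgetArc vx s₂ = true
gadgetArc vy s₁ = true
gadgetArc vy s₂ = true
gadgetArc vy vt = true
gadgetArc _  _  = false

gadgetGraph : Graph 5
gadgetGraph = record
  { adj     = λ i j → gadgetArc i j ∨ gadgetArc j i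
  ; adj-sym = λ i j → ∨-comm (gadgetArc i j) (gadgetArc j i)
  }

-- Once A and L are closed terms the right-hand side computes; the left one is stuck on X.
summand-reorder : ∀ A X L →
  (if (A ∧ not X) ∧ L then 1 else 0) ≡ (if A ∧ L then (if X then 0 else 1) else 0)
summand-reorder false X     L     = refl
summand-reorder true  true  false = refl
summand-reorder true  true  true  = refl
summand-reorder true  false L     = refl

+-regroup : ∀ a b c d e → (a + (b + 0)) + ((c + (d + (e + 0))) + 0) ≡ (a + c) + (b + d) + e
+-regroup = solve-∀

module Gadget {n} (H : Graph n) (a b c d p q t : Fin n) where

  lists : Fin 5 → Subset n
  lists vx = ⁅ a ⁆ ∪ ⁅ b ⁆
  lists vy = ⁅ c ⁆ ∪ ⁅ d ⁆
  lists s₁ = ⁅ p ⁆ ∪ ⁅ q ⁆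
  lists s₂ = ⁅ p ⁆ ∪ ⁅ q ⁆
  lists vt = ⁅ t ⁆

  move : Move n
  move = record { m = 5 ; J = gadgetGraph ; L = lists ; x = vx ; y = vy }

  open MoveCost H move

  miss : Fin n → Fin n → ℕ
  miss u w = if adj H u w then 0 else 1

  through : Fin n → Fin n → Fin n → ℕ
  through u v s = miss u s + miss v s

  best : Fin n → Fin n → ℕ
  best u v = through u v p ⊓ through u v q

  gadgetCost : Fin n → Fin n → ℕ
  gadgetCost u v = best u v + best u v + miss v t

  gadget-violations : ∀ ψ → violations gadgetGraph H ψ ≡
    through (ψ vx) (ψ vy) (ψ s₁) + through (ψ vx) (ψ vy) (ψ s₂) + miss (ψ vy) (ψ vt)
  gadget-violations ψ = trans
    (sumFin-cong λ i → sumFin-cong λ j →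
      summand-reorder (adj gadgetGraph i j) (adj H (ψ i) (ψ j)) (toℕ i ≤ᵇ toℕ j))
    (+-regroup (miss (ψ vx) (ψ s₁)) (miss (ψ vx) (ψ s₂))
                (miss (ψ vy) (ψ s₁)) (miss (ψ vy) (ψ s₂)) (miss (ψ vy) (ψ vt)))

  best≤through : ∀ u v {s} → s ∈ ⁅ p ⁆ ∪ ⁅ q ⁆ → best u v ≤ through u v s
  best≤through u v s∈ with ∈-pair⁻ s∈
  ... | inj₁ refl = m⊓n≤m _ _
  ... | inj₂ refl = m⊓n≤n _ _

  best-attained : ∀ u v → ∃ λ s → s ∈ ⁅ p ⁆ ∪ ⁅ q ⁆ × through u v s ≡ best u v
  best-attained u v with ⊓-sel (through u v p) (through u v q)
  ... | inj₁ best≡p = p , ∈-pairˡ p q , sym best≡p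
  ... | inj₂ best≡q = q , ∈-pairʳ p q , sym best≡q

  routedThrough : Fin n → Fin n → Fin n → Fin 5 → Fin n
  routedThrough u v s vx = u
  routedThrough u v s vy = v
  routedThrough u v s s₁ = s
  routedThrough u v s s₂ = s
  routedThrough u v s vt = t

  gadget-hasCost : ∀ {u v} → u ∈ ⁅ a ⁆ ∪ ⁅ b ⁆ → v ∈ ⁅ c ⁆ ∪ ⁅ d ⁆ →
    HasCost H move u v (just (gadgetCost u v))
  gadget-hasCost {u} {v} u∈ v∈ with best-attained u v
  ... | s , s∈ , through≡best =
    hasCost-of-optimal (routedThrough u v s) (listed , refl , refl) attained lower
    where
    listed : ∀ w → routedThrough u v s w ∈ lists w
    listed vx = u∈
    listed vy = v∈
    listed s₁ = s∈
    listed s₂ = s∈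
    listed vt = x∈⁅x⁆ t
    attained : violations gadgetGraph H (routedThrough u v s) ≡ gadgetCost u v
    attained rewrite gadget-violations (routedThrough u v s) | through≡best = refl
    lower : ∀ ψ → ListMap u v ψ → gadgetCost u v ≤ violations gadgetGraph H ψ
    lower ψ (ψ∈L , refl , refl) rewrite gadget-violations ψ | x∈⁅y⁆⇒x≡y t (ψ∈L vt) =
      +-mono-≤ (+-mono-≤ (best≤through u v (ψ∈L s₁)) (best≤through u v (ψ∈L s₂))) ≤-refl

  gadget-arrow : gadgetCost a c < gadgetCost a d × gadgetCost b d < gadgetCost b c → Arrow H a b c d
  gadget-arrow (ac<ad , bd<bc) = move , refl , refl ,
    forces-by-cost (∈-pairˡ c d) (λ _ → ∈-pair⁻)
      (gadget-hasCost (∈-pairˡ a b) (∈-pairˡ c d)) (gadget-hasCost (∈-pairˡ a b) (∈-pairʳ c d)) ac<ad ,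
    forces-by-cost (∈-pairʳ c d) (λ _ → swap ∘ ∈-pair⁻)
      (gadget-hasCost (∈-pairʳ a b) (∈-pairʳ c d)) (gadget-hasCost (∈-pairʳ a b) (∈-pairˡ c d)) bd<bc

module Configurations {n} (H : Graph n) (a b c : Fin n) where

  _~_ _≁_ : Fin n → Fin n → Set
  u ~ w = adj H u w ≡ true
  u ≁ w = adj H u w ≡ false

  fixing-a : ∀ p q t → a ~ p → b ≁ p → c ≁ p → a ≁ q → b ~ q → c ~ q → a ≁ t → c ~ t →
    Arrow H a b a c
  fixing-a p q t ap bp cp aq bq cq at ct = gadget-arrow costs
    where
    open Gadget H a b a c p q t
    costs : gadgetCost a a < gadgetCost a c × gadgetCost b c < gadgetCost b a
    costs rewrite ap | bp | cp | aq | bq | cq | at | ct = <ᵇ⇒< _ _ _ , <ᵇ⇒< _ _ _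

  swapping-common : ∀ p q t → a ~ p → b ≁ p → c ~ p → a ~ q → b ~ q → c ≁ q → a ≁ t → c ~ t →
    Arrow H a b c a
  swapping-common p q t ap bp cp aq bq cq at ct = gadget-arrow costs
    where
    open Gadget H a b c a p q t
    costs : gadgetCost a c < gadgetCost a a × gadgetCost b a < gadgetCost b c
    costs rewrite ap | bp | cp | aq | bq | cq | at | ct = <ᵇ⇒< _ _ _ , <ᵇ⇒< _ _ _

  swapping-private : ∀ p q t → a ≁ p → b ~ p → c ≁ p → a ≁ q → b ≁ q → c ~ q → a ~ t → c ≁ t →
    Arrow H a b c a
  swapping-private p q t ap bp cp aq bq cq at ct = gadget-arrow costs
    where
    open Gadget H a b c a p q t
    costs : gadgetCost a c < gadgetCost a a × gadgetCost b a < gadgetCost b c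
    costs rewrite ap | bp | cp | aq | bq | cq | at | ct = <ᵇ⇒< _ _ _ , <ᵇ⇒< _ _ _

  leads-from-witnesses : ∀ {b' a' c' a''} → a ~ b' → b ≁ b' → b ~ a' → a ≁ a' →
    a ~ c' → c ≁ c' → c ~ a'' → a ≁ a'' → Leads H a b a c
  leads-from-witnesses {b'} {a'} {c'} {a''} ab' bb' ba' aa' ac' cc' ca'' aa''
    with adj H c b' in cb' | adj H b c' in bc' | adj H c a' in ca' | adj H b a'' in ba''
  ... | true  | true  | _     | _     = inj₂ (swapping-common b' c' a'' ab' bb' cb' ac' bc' cc' aa'' ca'')
  ... | false | _     | true  | _     = inj₁ (fixing-a b' a' a'' ab' bb' cb' aa' ba' ca' aa'' ca'')
  ... | false | _     | _     | true  = inj₁ (fixing-a b' a'' a'' ab' bb' cb' aa'' ba'' ca'' aa'' ca'')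
  ... | _     | false | true  | _     = inj₁ (fixing-a c' a' a'' ac' bc' cc' aa' ba' ca' aa'' ca'')
  ... | _     | false | _     | true  = inj₁ (fixing-a c' a'' a'' ac' bc' cc' aa'' ba'' ca'' aa'' ca'')
  ... | _     | _     | false | false = inj₂ (swapping-private a' a'' c' aa' ba' ca' aa'' ba'' ca'' ac' cc')

lemma7p20 : ∀ {n : ℕ} (H : Graph n) (a b c : Fin n) →
    Incomparable H a b → Incomparable H a c → Leads H a b a c
lemma7p20 H a b c (_ , a⊈b , b⊈a) (_ , a⊈c , c⊈a)
  with ¬NbhdSub⇒∃ H a b a⊈b | ¬NbhdSub⇒∃ H b a b⊈a | ¬NbhdSub⇒∃ H a c a⊈c | ¬NbhdSub⇒∃ H c a c⊈a
... | _ , ab' , bb' | _ , ba' , aa' | _ , ac' , cc' | _ , ca'' , aa'' =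
  Configurations.leads-from-witnesses H a b c ab' bb' ba' aa' ac' cc' ca'' aa''
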